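{- $M_2 \models T_1$.
   Context: $T_{1}$ is the $\mathcal L_1$-theory axiomatized by the universal closures of: $\mathit{nil}\neq\mathit{cons}(x,X)$; $\mathit{cons}(x,X)=\mathit{cons}(y,Y)\rightarrow x=y\wedge X=Y$; $\mathit{nil}\frown Y=Y$; $\mathit{cons}(x,X)\frown Y=\mathit{cons}(x,X\frown Y)$, where $\mathcal L_1$ has sorts $\mathsf i$, $\mathsf{list}$ and symbols $\mathit{nil}:\mathsf{list}$, $\mathit{cons}:\mathsf i\times\mathsf{list}\to\mathsf{list}$, infix $\frown:\mathsf{list}\times\mathsf{list}\to\mathsf{list}$. Sequences: $\mathcal X^\alpha$ is the set of functions $\alpha\to\mathcal X$; $\mathbb N^*$ the finite sequences of naturals; $\varepsilon$ the empty sequence, $(n)$ a one-element sequence. For $a\in\mathcal X^\alpha$, $b\in\mathcal X^\beta$, $a\frown b\in\mathcal X^{\alpha+\beta}$ with $(a\frown b)_\gamma=a_\gamma$ for $\gamma<\alpha$ and $(a\frown b)_{\alpha+\delta}=b_\delta$. For $\alpha>0$ and $\mathfrak a\in(\mathcal X^\alpha)^\beta$, $\lfloor\mathfrak a\rfloor\in\mathcal X^{\alpha\cdot\beta}$ with $\lfloor\mathfrak a\rfloor_{\alpha\cdot\delta+\mu}=(\mathfrak a_\delta)_\mu$ for $\mu<\alpha$. $N_k=(i)_{k\le i<\omega}$, $\mathcal N=\{w\frown N_k: w\in\mathbb N^*,k\in\mathbb N\}$. The structure $M_2$ interprets $\mathsf i$ as $\mathbb N$, $\mathsf{list}$ as $\mathfrak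 L=\{\lfloor\mathfrak l\rfloor\frown w: w\in\mathbb N^*, \mathfrak l\in\mathcal N^\beta,\beta<\omega^2\}$, $\mathit{nil}$ as $\varepsilon$, $\mathit{cons}(n,l)$ as $(n)\frown l$, and $\frown$ as concatenation. -}

module Defs where

open import Data.Nat using (ℕ; zero; suc; _+_; _∸_; _<ᵇ_; _≡ᵇ_)
open import Data.Bool using (Bool; true; false; _∧_; _∨_; if_then_else_; T)
open import Data.List using (List; []; _∷_; length)
open import Data.Product using (Σ; _×_; _,_)
open import Relation.Binary.PropositionalEquality using (_≡_)

-- Ordinals below ω³ in Cantor normal form: ⟨ a , b , c ⟩ = ω²·a + ω·b + c.
-- (All lists of M₂ have length < ω³: ω·β + n with β < ω².)

record Ord3 : Set where
  constructor ⟨_,_,_⟩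
  field
    o2 o1 o0 : ℕ
open Ord3 public

ltb : Ord3 → Ord3 → Bool
ltb ⟨ a , b , c ⟩ ⟨ a' , b' , c' ⟩ =
  (a <ᵇ a') ∨ ((a ≡ᵇ a') ∧ ((b <ᵇ b') ∨ ((b ≡ᵇ b') ∧ (c <ᵇ c'))))

_<o_ : Ord3 → Ord3 → Set
γ <o α = T (ltb γ α)

_+o_ : Ord3 → Ord3 → Ord3
⟨ a , b , c ⟩ +o ⟨ zero , zero , c' ⟩ = ⟨ a , b , c + c' ⟩
⟨ a , b , c ⟩ +o ⟨ zero , suc b' , c' ⟩ = ⟨ a , b + suc b' , c' ⟩
⟨ a , b , c ⟩ +o ⟨ suc a' , b' , c' ⟩ = ⟨ a + suc a' , b' , c' ⟩

-- left subtraction: for α ≤ γ, (γ -o α) is the unique δ with α +o δ = γ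
_-o_ : Ord3 → Ord3 → Ord3
⟨ a , b , c ⟩ -o ⟨ a' , b' , c' ⟩ =
  if a' <ᵇ a then ⟨ a ∸ a' , b , c ⟩
  else if b' <ᵇ b then ⟨ 0 , b ∸ b' , c ⟩
  else ⟨ 0 , 0 , c ∸ c' ⟩

ω : Ord3
ω = ⟨ 0 , 1 , 0 ⟩

-- Transfinite sequences of naturals of length < ω³:  an element of ℕ^len.
-- The values of 'at' at indices ≥ len are irrelevant; sequences are
-- compared with the extensional equality _≈_ below (= equality of the
-- functions len → ℕ).

record Seq : Set where
  constructor mkSeq
  field
    len : Ord3
    at  : Ord3 → ℕ
open Seq public

_≈_ : Seq → Seq → Set
s ≈ t = (len s ≡ len t) × ((γ : Ord3) → γ <o len s → at s γ ≡ at t γ)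

εs : Seq
εs = mkSeq ⟨ 0 , 0 , 0 ⟩ (λ _ → 0)

[_]s : ℕ → Seq
[ n ]s = mkSeq ⟨ 0 , 0 , 1 ⟩ (λ _ → n)

_⁀_ : Seq → Seq → Seq
s ⁀ t = mkSeq (len s +o len t)
              (λ γ → if ltb γ (len s) then at s γ else at t (γ -o len s))

lookupD : List ℕ → ℕ → ℕ
lookupD []       _       = 0
lookupD (x ∷ _)  zero    = x
lookupD (_ ∷ xs) (suc i) = lookupD xs i

fromList : List ℕ → Seq
fromList w = mkSeq ⟨ 0 , 0 , length w ⟩ (λ γ → lookupD w (o0 γ))

Nk : ℕ → Seq
Nk k = mkSeq ω (λ γ → k + o0 γ)

𝒩elt : List ℕ × ℕ → Seq
𝒩elt (w , k) = fromList w ⁀ Nk k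

-- ⌊𝔞⌋ for 𝔞 ∈ (ℕ^ω)^β, β < ω² (the only instance of ⌊·⌋ used in M₂,
-- since all elements of 𝒩 have length ω):
-- ⌊𝔞⌋ has length ω·β and ⌊𝔞⌋_{ω·δ+μ} = (𝔞_δ)_μ for μ < ω.
-- For β = ω·b + c we have ω·β = ω²·b + ω·c, and an index
-- ω²·a + ω·b' + c' = ω·(ω·a + b') + c'.
floorω : (Ord3 → Seq) → Ord3 → Seq
floorω 𝔞 β = mkSeq ⟨ o1 β , o0 β , 0 ⟩
                   (λ γ → at (𝔞 ⟨ 0 , o2 γ , o1 γ ⟩) ⟨ 0 , 0 , o0 γ ⟩)

-- 𝔏 = { ⌊𝔩⌋ ⁀ w : w ∈ ℕ*, 𝔩 ∈ 𝒩^β, β < ω² }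
-- (𝔩 is given by codes (w_δ , k_δ) with 𝔩_δ = w_δ ⁀ N_{k_δ};
--  β < ω² means o2 β ≡ 0; membership is up to equality _≈_ of sequences)
In𝔏 : Seq → Set
In𝔏 s = Σ (List ℕ) λ w → Σ Ord3 λ β → Σ (Ord3 → List ℕ × ℕ) λ 𝔩 →
          (o2 β ≡ 0) × (s ≈ (floorω (λ δ → 𝒩elt (𝔩 δ)) β ⁀ fromList w))

-- The structure M₂: i ↦ ℕ, list ↦ 𝔏, nil ↦ ε, cons(n,l) ↦ (n)⁀l, ⁀ ↦ ⁀.

nil₂ : Seq
nil₂ = εs

cons₂ : ℕ → Seq → Seq
cons₂ n l = [ n ]s ⁀ l

M₂-isStructure : Set
M₂-isStructure =
  In𝔏 nil₂
  × (∀ n l → In𝔏 l → In𝔏 (cons₂ n l))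
  × (∀ l m → In𝔏 l → In𝔏 m → In𝔏 (l ⁀ m))

-- M₂ ⊨ T₁: the universal closures of the four axioms hold
-- (variables of sort i range over ℕ, of sort list over 𝔏).
M₂⊨T₁ : Set
M₂⊨T₁ =
  (∀ x X → In𝔏 X → ¬' (nil₂ ≈ cons₂ x X))
  × (∀ x X y Y → In𝔏 X → In𝔏 Y →
       cons₂ x X ≈ cons₂ y Y → (x ≡ y) × (X ≈ Y))
  × (∀ Y → In𝔏 Y → (nil₂ ⁀ Y) ≈ Y)
  × (∀ x X Y → In𝔏 X → In𝔏 Y → (cons₂ x X ⁀ Y) ≈ cons₂ x (X ⁀ Y))
  where
    open import Data.Empty using (⊥)
    ¬' : Set → Set
    ¬' P = P → ⊥

-- Concatenation of transfinite sequences is associative with unit ε, and ordinal addition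
-- is left-cancellative, so (n) ⁀ X determines n and X: this gives the four axioms.
-- For closure of 𝔏 under ⁀, in (⌊𝔩⌋ ⁀ v) ⁀ (⌊𝔪⌋ ⁀ w) the finite word v is absorbed into the
-- first ω-block of 𝔪, since v ⁀ (u ⁀ N_k) = (v ⁀ u) ⁀ N_k; the two floors then merge into the
-- floor of the concatenated block sequence. If 𝔪 is empty, v ⁀ w is again a finite word.

module Submission where

open import Defs
open import Data.Nat using (ℕ; zero; suc; _+_; _∸_; _<ᵇ_; _≡ᵇ_)
open import Data.Nat.Properties using (+-assoc; +-identityʳ; n∸n≡0; m+n∸m≡n)
open import Data.Bool using (true; false; if_then_else_; T; _∧_; _∨_)
open import Data.Bool.Properties using (T-≡; ∧-zeroʳ; ∨-identityʳ)
open import Data.List using (List; []; _∷_; length; _++_)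
open import Data.List.Properties using (length-++)
open import Data.Product using (_×_; _,_; proj₁; proj₂; map₁)
open import Data.Empty using (⊥-elim)
open import Function.Bundles using (Equivalence)
open import Level using (0ℓ)
open import Relation.Nullary using (¬_)
open import Relation.Binary.Bundles using (Setoid)
open import Relation.Binary.PropositionalEquality
import Relation.Binary.Reasoning.Setoid as SetoidReasoning

-- Data.Nat's compare, but with the gap written m + suc k, the shape produced by _+o_.
data Trichotomy : ℕ → ℕ → Set where
  less    : ∀ m k → Trichotomy m (m + suc k)
  equal   : ∀ m → Trichotomy m m
  greater : ∀ m k → Trichotomy (m + suc k) m

trichotomy : ∀ m n → Trichotomy m n
trichotomy zero    zero    = equal 0
trichotomy zero    (suc n) = less 0 n
trichotomy (suc m) zero    = greater 0 m
trichotomy (suc m) (suc n) with trichotomy m n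
... | less    .m k = less (suc m) k
... | equal   .m   = equal (suc m)
... | greater .n k = greater (suc n) k

n<ᵇn≡false : ∀ n → (n <ᵇ n) ≡ false
n<ᵇn≡false zero    = refl
n<ᵇn≡false (suc n) = n<ᵇn≡false n

n≡ᵇn≡true : ∀ n → (n ≡ᵇ n) ≡ true
n≡ᵇn≡true zero    = refl
n≡ᵇn≡true (suc n) = n≡ᵇn≡true n

n<ᵇn+1+k≡true : ∀ n k → (n <ᵇ n + suc k) ≡ true
n<ᵇn+1+k≡true zero    k = refl
n<ᵇn+1+k≡true (suc n) k = n<ᵇn+1+k≡true n k

n+k<ᵇn≡false : ∀ n k → (n + k <ᵇ n) ≡ false
n+k<ᵇn≡false zero    k = refl
n+k<ᵇn≡false (suc n) k = n+k<ᵇn≡false n k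

n+1+k≡ᵇn≡false : ∀ n k → (n + suc k ≡ᵇ n) ≡ false
n+1+k≡ᵇn≡false zero    k = refl
n+1+k≡ᵇn≡false (suc n) k = n+1+k≡ᵇn≡false n k

+-cancelˡ-<ᵇ : ∀ n a b → (n + a <ᵇ n + b) ≡ (a <ᵇ b)
+-cancelˡ-<ᵇ zero    a b = refl
+-cancelˡ-<ᵇ (suc n) a b = +-cancelˡ-<ᵇ n a b

+-cancelˡ-≡ᵇ : ∀ n a b → (n + a ≡ᵇ n + b) ≡ (a ≡ᵇ b)
+-cancelˡ-≡ᵇ zero    a b = refl
+-cancelˡ-≡ᵇ (suc n) a b = +-cancelˡ-≡ᵇ n a b

0o : Ord3
0o = ⟨ 0 , 0 , 0 ⟩

1o : Ord3
1o = ⟨ 0 , 0 , 1 ⟩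

γ≮0 : ∀ γ → ltb γ 0o ≡ false
γ≮0 ⟨ zero  , zero  , _ ⟩ = refl
γ≮0 ⟨ zero  , suc _ , _ ⟩ = refl
γ≮0 ⟨ suc _ , _     , _ ⟩ = refl

+o-identityˡ : ∀ α → 0o +o α ≡ α
+o-identityˡ ⟨ zero  , zero  , _ ⟩ = refl
+o-identityˡ ⟨ zero  , suc _ , _ ⟩ = refl
+o-identityˡ ⟨ suc _ , _     , _ ⟩ = refl

+o-assoc : ∀ α β γ → (α +o β) +o γ ≡ α +o (β +o γ)
+o-assoc ⟨ a , b , c ⟩ ⟨ zero , zero  , q ⟩ ⟨ zero , zero  , r ⟩ = cong ⟨ a , b ,_⟩ (+-assoc c q r)
+o-assoc ⟨ a , b , c ⟩ ⟨ zero , suc q , _ ⟩ ⟨ zero , suc r , s ⟩ = cong (λ x → ⟨ a , x , s ⟩) (+-assoc b (suc q) (suc r))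
+o-assoc ⟨ a , b , c ⟩ ⟨ suc p , _ , _ ⟩ ⟨ suc r , t , s ⟩ = cong (λ x → ⟨ x , t , s ⟩) (+-assoc a (suc p) (suc r))
+o-assoc ⟨ _ , _ , _ ⟩ ⟨ zero  , suc _ , _ ⟩ ⟨ zero , zero  , _ ⟩ = refl
+o-assoc ⟨ _ , _ , _ ⟩ ⟨ suc _ , _     , _ ⟩ ⟨ zero , zero  , _ ⟩ = refl
+o-assoc ⟨ _ , _ , _ ⟩ ⟨ zero  , zero  , _ ⟩ ⟨ zero , suc _ , _ ⟩ = refl
+o-assoc ⟨ _ , _ , _ ⟩ ⟨ suc _ , _     , _ ⟩ ⟨ zero , suc _ , _ ⟩ = refl
+o-assoc ⟨ _ , _ , _ ⟩ ⟨ zero  , zero  , _ ⟩ ⟨ suc _ , _ , _ ⟩ = refl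
+o-assoc ⟨ _ , _ , _ ⟩ ⟨ zero  , suc _ , _ ⟩ ⟨ suc _ , _ , _ ⟩ = refl

α+δ≮α : ∀ α δ → ltb (α +o δ) α ≡ false
α+δ≮α ⟨ a , b , c ⟩ ⟨ zero , zero , r ⟩
  rewrite n<ᵇn≡false a | n≡ᵇn≡true a | n<ᵇn≡false b | n≡ᵇn≡true b | n+k<ᵇn≡false c r = refl
α+δ≮α ⟨ a , b , c ⟩ ⟨ zero , suc q , _ ⟩
  rewrite n<ᵇn≡false a | n≡ᵇn≡true a | n+k<ᵇn≡false b (suc q) | n+1+k≡ᵇn≡false b q = refl
α+δ≮α ⟨ a , b , c ⟩ ⟨ suc p , _ , _ ⟩
  rewrite n+k<ᵇn≡false a (suc p) | n+1+k≡ᵇn≡false a p = refl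

[α+δ]-α≡δ : ∀ α δ → (α +o δ) -o α ≡ δ
[α+δ]-α≡δ ⟨ a , b , c ⟩ ⟨ zero , zero , r ⟩
  rewrite n<ᵇn≡false a | n<ᵇn≡false b | m+n∸m≡n c r = refl
[α+δ]-α≡δ ⟨ a , b , c ⟩ ⟨ zero , suc q , _ ⟩
  rewrite n<ᵇn≡false a | n<ᵇn+1+k≡true b q | m+n∸m≡n b (suc q) = refl
[α+δ]-α≡δ ⟨ a , b , c ⟩ ⟨ suc p , _ , _ ⟩
  rewrite n<ᵇn+1+k≡true a p | m+n∸m≡n a (suc p) = refl

α+[γ-α]≡γ : ∀ γ α → ltb γ α ≡ false → α +o (γ -o α) ≡ γ
α+[γ-α]≡γ ⟨ x , y , z ⟩ ⟨ a , b , c ⟩ γ≮α with trichotomy x a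
α+[γ-α]≡γ ⟨ x , _ , _ ⟩ ⟨ _ , _ , _ ⟩ γ≮α | less .x k
  rewrite n<ᵇn+1+k≡true x k with () ← γ≮α
α+[γ-α]≡γ ⟨ _ , _ , _ ⟩ ⟨ a , _ , _ ⟩ _ | greater .a k
  rewrite n<ᵇn+1+k≡true a k | m+n∸m≡n a (suc k) = refl
α+[γ-α]≡γ ⟨ a , y , z ⟩ ⟨ .a , b , c ⟩ γ≮α | equal .a with trichotomy y b
... | less .y k
  rewrite n<ᵇn≡false a | n≡ᵇn≡true a | n<ᵇn+1+k≡true y k with () ← γ≮α
... | greater .b k
  rewrite n<ᵇn≡false a | n<ᵇn+1+k≡true b k | m+n∸m≡n b (suc k) = refl
... | equal .b with trichotomy z c
...   | less .z k
  rewrite n<ᵇn≡false a | n≡ᵇn≡true a | n<ᵇn≡false b | n≡ᵇn≡true b | n<ᵇn+1+k≡true z k with () ← γ≮α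
...   | greater .c k
  rewrite n<ᵇn≡false a | n<ᵇn≡false b | m+n∸m≡n c (suc k) = refl
...   | equal .c
  rewrite n<ᵇn≡false a | n<ᵇn≡false b | n∸n≡0 c | +-identityʳ c = refl

+o-cancelˡ-ltb : ∀ α δ β → ltb (α +o δ) (α +o β) ≡ ltb δ β
+o-cancelˡ-ltb ⟨ a , b , c ⟩ ⟨ zero , zero , r ⟩ ⟨ zero , zero , r' ⟩
  rewrite n<ᵇn≡false a | n≡ᵇn≡true a | n<ᵇn≡false b | n≡ᵇn≡true b | +-cancelˡ-<ᵇ c r r' = refl
+o-cancelˡ-ltb ⟨ a , b , c ⟩ ⟨ zero , zero , r ⟩ ⟨ zero , suc q' , r' ⟩
  rewrite n<ᵇn≡false a | n≡ᵇn≡true a | n<ᵇn+1+k≡true b q' = refl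
+o-cancelˡ-ltb ⟨ a , b , c ⟩ ⟨ zero , zero , r ⟩ ⟨ suc p' , q' , r' ⟩
  rewrite n<ᵇn+1+k≡true a p' = refl
+o-cancelˡ-ltb ⟨ a , b , c ⟩ ⟨ zero , suc q , r ⟩ ⟨ zero , zero , r' ⟩
  rewrite n<ᵇn≡false a | n≡ᵇn≡true a | n+k<ᵇn≡false b (suc q) | n+1+k≡ᵇn≡false b q = refl
+o-cancelˡ-ltb ⟨ a , b , c ⟩ ⟨ zero , suc q , r ⟩ ⟨ zero , suc q' , r' ⟩
  rewrite n<ᵇn≡false a | n≡ᵇn≡true a | +-cancelˡ-<ᵇ b (suc q) (suc q') | +-cancelˡ-≡ᵇ b (suc q) (suc q') = refl
+o-cancelˡ-ltb ⟨ a , b , c ⟩ ⟨ zero , suc q , r ⟩ ⟨ suc p' , q' , r' ⟩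
  rewrite n<ᵇn+1+k≡true a p' = refl
+o-cancelˡ-ltb ⟨ a , b , c ⟩ ⟨ suc p , q , r ⟩ ⟨ zero , zero , r' ⟩
  rewrite n+k<ᵇn≡false a (suc p) | n+1+k≡ᵇn≡false a p = refl
+o-cancelˡ-ltb ⟨ a , b , c ⟩ ⟨ suc p , q , r ⟩ ⟨ zero , suc q' , r' ⟩
  rewrite n+k<ᵇn≡false a (suc p) | n+1+k≡ᵇn≡false a p = refl
+o-cancelˡ-ltb ⟨ a , b , c ⟩ ⟨ suc p , q , r ⟩ ⟨ suc p' , q' , r' ⟩
  rewrite +-cancelˡ-<ᵇ a (suc p) (suc p') | +-cancelˡ-≡ᵇ a (suc p) (suc p') = refl

<o⇒ltb≡true : ∀ γ α → γ <o α → ltb γ α ≡ true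
<o⇒ltb≡true γ α = Equivalence.to (T-≡ {ltb γ α})

+o-cancelˡ-<o : ∀ α δ β → (α +o δ) <o (α +o β) → δ <o β
+o-cancelˡ-<o α δ β = subst T (+o-cancelˡ-ltb α δ β)

+o-monoʳ-<o : ∀ α δ β → δ <o β → (α +o δ) <o (α +o β)
+o-monoʳ-<o α δ β = subst T (sym (+o-cancelˡ-ltb α δ β))

+o-cancelˡ-≡ : ∀ α {β β'} → α +o β ≡ α +o β' → β ≡ β'
+o-cancelˡ-≡ α {β} {β'} eq = begin
  β                   ≡⟨ [α+δ]-α≡δ α β ⟨
  (α +o β) -o α       ≡⟨ cong (_-o α) eq ⟩
  (α +o β') -o α      ≡⟨ [α+δ]-α≡δ α β' ⟩
  β'                  ∎
  where open ≡-Reasoning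

0<1+α : ∀ α → 0o <o (1o +o α)
0<1+α ⟨ zero  , zero  , _ ⟩ = _
0<1+α ⟨ zero  , suc _ , _ ⟩ = _
0<1+α ⟨ suc _ , _     , _ ⟩ = _

data Position (α : Ord3) : Ord3 → Set where
  below : ∀ {γ} → γ <o α → Position α γ
  above : ∀ δ → Position α (α +o δ)

position : ∀ α γ → Position α γ
position α γ with ltb γ α in γ<α
... | true  = below (Equivalence.from T-≡ γ<α)
... | false = subst (Position α) (α+[γ-α]≡γ γ α γ<α) (above (γ -o α))

≈-refl : ∀ {s} → s ≈ s
≈-refl = refl , λ _ _ → refl

≈-sym : ∀ {s t} → s ≈ t → t ≈ s
≈-sym (refl , h) = refl , λ γ γ<s → sym (h γ γ<s)

≈-trans : ∀ {s t u} → s ≈ t → t ≈ u → s ≈ u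
≈-trans (refl , h) (refl , k) = refl , λ γ γ<s → trans (h γ γ<s) (k γ γ<s)

≈-setoid : Setoid 0ℓ 0ℓ
≈-setoid = record
  { Carrier       = Seq
  ; _≈_           = _≈_
  ; isEquivalence = record { refl = ≈-refl ; sym = ≈-sym ; trans = ≈-trans }
  }

-- at (s ⁀ t) is definitionally splice (len s) (at s) (at t).
splice : {A : Set} → Ord3 → (Ord3 → A) → (Ord3 → A) → Ord3 → A
splice α f g γ = if ltb γ α then f γ else g (γ -o α)

splice-< : ∀ {A : Set} α (f g : Ord3 → A) γ → γ <o α → splice α f g γ ≡ f γ
splice-< α f g γ γ<α = cong (if_then f γ else g (γ -o α)) (<o⇒ltb≡true γ α γ<α)

splice-+o : ∀ {A : Set} α (f g : Ord3 → A) δ → splice α f g (α +o δ) ≡ g δ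
splice-+o α f g δ = begin
  splice α f g (α +o δ)  ≡⟨ cong (if_then f (α +o δ) else g ((α +o δ) -o α)) (α+δ≮α α δ) ⟩
  g ((α +o δ) -o α)      ≡⟨ cong g ([α+δ]-α≡δ α δ) ⟩
  g δ                    ∎
  where open ≡-Reasoning

at-⁀ˡ : ∀ s t {γ} → γ <o len s → at (s ⁀ t) γ ≡ at s γ
at-⁀ˡ s t {γ} = splice-< (len s) (at s) (at t) γ

at-⁀ʳ : ∀ s t δ → at (s ⁀ t) (len s +o δ) ≡ at t δ
at-⁀ʳ s t = splice-+o (len s) (at s) (at t)

⁀-cong : ∀ {s s' t t'} → s ≈ s' → t ≈ t' → (s ⁀ t) ≈ (s' ⁀ t')
⁀-cong {s} {s'} {t} {t'} (refl , s≗s') (refl , t≗t') = refl , pointwise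
  where
  open ≡-Reasoning
  pointwise : ∀ γ → γ <o len (s ⁀ t) → at (s ⁀ t) γ ≡ at (s' ⁀ t') γ
  pointwise γ γ<st with position (len s) γ
  ... | below γ<s = begin
    at (s ⁀ t) γ    ≡⟨ at-⁀ˡ s t γ<s ⟩
    at s γ          ≡⟨ s≗s' γ γ<s ⟩
    at s' γ         ≡⟨ at-⁀ˡ s' t' γ<s ⟨
    at (s' ⁀ t') γ  ∎
  ... | above δ = begin
    at (s ⁀ t) (len s +o δ)    ≡⟨ at-⁀ʳ s t δ ⟩
    at t δ                     ≡⟨ t≗t' δ (+o-cancelˡ-<o (len s) δ (len t) γ<st) ⟩
    at t' δ                    ≡⟨ at-⁀ʳ s' t' δ ⟨
    at (s' ⁀ t') (len s +o δ)  ∎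

⁀-congˡ : ∀ s {t t'} → t ≈ t' → (s ⁀ t) ≈ (s ⁀ t')
⁀-congˡ s = ⁀-cong (≈-refl {s})

⁀-congʳ : ∀ u {s s'} → s ≈ s' → (s ⁀ u) ≈ (s' ⁀ u)
⁀-congʳ u s≈s' = ⁀-cong s≈s' (≈-refl {u})

⁀-assoc : ∀ s t u → ((s ⁀ t) ⁀ u) ≈ (s ⁀ (t ⁀ u))
⁀-assoc s t u = +o-assoc (len s) (len t) (len u) , pointwise
  where
  open ≡-Reasoning
  pointwise : ∀ γ → γ <o len ((s ⁀ t) ⁀ u) → at ((s ⁀ t) ⁀ u) γ ≡ at (s ⁀ (t ⁀ u)) γ
  pointwise γ _ with position (len (s ⁀ t)) γ
  pointwise γ _ | below γ<st with position (len s) γ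
  ... | below γ<s = begin
    at ((s ⁀ t) ⁀ u) γ  ≡⟨ at-⁀ˡ (s ⁀ t) u γ<st ⟩
    at (s ⁀ t) γ        ≡⟨ at-⁀ˡ s t γ<s ⟩
    at s γ              ≡⟨ at-⁀ˡ s (t ⁀ u) γ<s ⟨
    at (s ⁀ (t ⁀ u)) γ  ∎
  ... | above δ = begin
    at ((s ⁀ t) ⁀ u) (len s +o δ)  ≡⟨ at-⁀ˡ (s ⁀ t) u γ<st ⟩
    at (s ⁀ t) (len s +o δ)        ≡⟨ at-⁀ʳ s t δ ⟩
    at t δ                         ≡⟨ at-⁀ˡ t u (+o-cancelˡ-<o (len s) δ (len t) γ<st) ⟨
    at (t ⁀ u) δ                   ≡⟨ at-⁀ʳ s (t ⁀ u) δ ⟨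
    at (s ⁀ (t ⁀ u)) (len s +o δ)  ∎
  pointwise _ _ | above δ = begin
    at ((s ⁀ t) ⁀ u) (len (s ⁀ t) +o δ)        ≡⟨ at-⁀ʳ (s ⁀ t) u δ ⟩
    at u δ                                     ≡⟨ at-⁀ʳ t u δ ⟨
    at (t ⁀ u) (len t +o δ)                    ≡⟨ at-⁀ʳ s (t ⁀ u) (len t +o δ) ⟨
    at (s ⁀ (t ⁀ u)) (len s +o (len t +o δ))   ≡⟨ cong (at (s ⁀ (t ⁀ u))) (+o-assoc (len s) (len t) δ) ⟨
    at (s ⁀ (t ⁀ u)) ((len s +o len t) +o δ)   ∎

⁀-identityˡ : ∀ s → (εs ⁀ s) ≈ s
⁀-identityˡ s = +o-identityˡ (len s) , λ γ _ → begin
  at (εs ⁀ s) γ         ≡⟨ cong (at (εs ⁀ s)) (+o-identityˡ γ) ⟨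
  at (εs ⁀ s) (0o +o γ) ≡⟨ at-⁀ʳ εs s γ ⟩
  at s γ                ∎
  where open ≡-Reasoning

εs≉[x]⁀X : ∀ x X → ¬ (εs ≈ ([ x ]s ⁀ X))
εs≉[x]⁀X x X (0≡1+X , _) = subst (0o <o_) (sym 0≡1+X) (0<1+α (len X))

⁀-cancelˡ : ∀ {s s' t t'} → len s ≡ len s' → (s ⁀ t) ≈ (s' ⁀ t') → t ≈ t'
⁀-cancelˡ {s} {s'} {t} {t'} refl (|st|≡|s't'| , st≗s't') =
  +o-cancelˡ-≡ (len s) |st|≡|s't'| , λ δ δ<t → begin
    at t δ                     ≡⟨ at-⁀ʳ s t δ ⟨
    at (s ⁀ t) (len s +o δ)    ≡⟨ st≗s't' (len s +o δ) (+o-monoʳ-<o (len s) δ (len t) δ<t) ⟩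
    at (s' ⁀ t') (len s +o δ)  ≡⟨ at-⁀ʳ s' t' δ ⟩
    at t' δ                    ∎
  where open ≡-Reasoning

[x]⁀-injective : ∀ x X y Y → ([ x ]s ⁀ X) ≈ ([ y ]s ⁀ Y) → (x ≡ y) × (X ≈ Y)
[x]⁀-injective x X y Y eq@(_ , x∷X≗y∷Y) = x∷X≗y∷Y 0o (0<1+α (len X)) , ⁀-cancelˡ refl eq

lookupD-++ : ∀ v w i → lookupD (v ++ w) i ≡ (if i <ᵇ length v then lookupD v i else lookupD w (i ∸ length v))
lookupD-++ []      w i       = refl
lookupD-++ (x ∷ v) w zero    = refl
lookupD-++ (x ∷ v) w (suc i) = lookupD-++ v w i

fromList-++ : ∀ v w → fromList (v ++ w) ≈ (fromList v ⁀ fromList w)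
fromList-++ v w = cong ⟨ 0 , 0 ,_⟩ (length-++ v) , pointwise
  where
  pointwise : ∀ γ → γ <o len (fromList (v ++ w)) → at (fromList (v ++ w)) γ ≡ at (fromList v ⁀ fromList w) γ
  pointwise ⟨ zero , zero , i ⟩ _ = lookupD-++ v w i

𝒩elt-++ : ∀ v w k → 𝒩elt (v ++ w , k) ≈ (fromList v ⁀ 𝒩elt (w , k))
𝒩elt-++ v w k = begin
  fromList (v ++ w) ⁀ Nk k            ≈⟨ ⁀-congʳ (Nk k) (fromList-++ v w) ⟩
  (fromList v ⁀ fromList w) ⁀ Nk k    ≈⟨ ⁀-assoc (fromList v) (fromList w) (Nk k) ⟩
  fromList v ⁀ (fromList w ⁀ Nk k)    ∎
  where open SetoidReasoning ≈-setoid

-- Meant for β < ω² (o2 β ≡ 0): then ω· β is the length of ⌊ 𝔩 ⌋ β, and every γ equals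
-- ω·(divω γ) + o0 γ, so block divω γ of ⌊ 𝔩 ⌋ is read at position o0 γ.
infix 30 ω·_

ω·_ : Ord3 → Ord3
ω· β = ⟨ o1 β , o0 β , 0 ⟩

divω : Ord3 → Ord3
divω γ = ⟨ 0 , o2 γ , o1 γ ⟩

ltb-ω· : ∀ b c γ → ltb γ (ω· ⟨ 0 , b , c ⟩) ≡ ltb (divω γ) ⟨ 0 , b , c ⟩
ltb-ω· b c ⟨ x , y , _ ⟩ = cong ((x <ᵇ b) ∨_) (cong ((x ≡ᵇ b) ∧_) (begin
  (y <ᵇ c) ∨ ((y ≡ᵇ c) ∧ false)  ≡⟨ cong ((y <ᵇ c) ∨_) (∧-zeroʳ (y ≡ᵇ c)) ⟩
  (y <ᵇ c) ∨ false               ≡⟨ ∨-identityʳ (y <ᵇ c) ⟩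
  y <ᵇ c                         ∎))
  where open ≡-Reasoning

divω-ω·+o : ∀ b c δ → divω (ω· ⟨ 0 , b , c ⟩ +o δ) ≡ ⟨ 0 , b , c ⟩ +o divω δ
divω-ω·+o b c ⟨ zero  , zero  , _ ⟩ = cong ⟨ 0 , b ,_⟩ (sym (+-identityʳ c))
divω-ω·+o b c ⟨ zero  , suc _ , _ ⟩ = refl
divω-ω·+o b c ⟨ suc _ , _     , _ ⟩ = refl

o0-ω·+o : ∀ β δ → o0 (ω· β +o δ) ≡ o0 δ
o0-ω·+o β ⟨ zero  , zero  , _ ⟩ = refl
o0-ω·+o β ⟨ zero  , suc _ , _ ⟩ = refl
o0-ω·+o β ⟨ suc _ , _     , _ ⟩ = refl

ω·-+o : ∀ b c b' c' → ω· (⟨ 0 , b , c ⟩ +o ⟨ 0 , b' , c' ⟩) ≡ ω· ⟨ 0 , b , c ⟩ +o ω· ⟨ 0 , b' , c' ⟩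
ω·-+o b c zero     zero    = cong ⟨ b ,_, 0 ⟩ (+-identityʳ c)
ω·-+o b c zero     (suc _) = refl
ω·-+o b c (suc _)  _       = refl

Blocks : Set
Blocks = Ord3 → List ℕ × ℕ

⌊_⌋ : Blocks → Ord3 → Seq
⌊ 𝔩 ⌋ = floorω (λ δ → 𝒩elt (𝔩 δ))

⌊⌋-0o : ∀ 𝔩 → ⌊ 𝔩 ⌋ 0o ≈ εs
⌊⌋-0o 𝔩 = refl , λ γ γ<0 → ⊥-elim (subst T (γ≮0 γ) γ<0)

⌊⌋-⁀-⌊⌋ : ∀ 𝔩 𝔪 b c b' c' → let β = ⟨ 0 , b , c ⟩; β' = ⟨ 0 , b' , c' ⟩ in
          (⌊ 𝔩 ⌋ β ⁀ ⌊ 𝔪 ⌋ β') ≈ ⌊ splice β 𝔩 𝔪 ⌋ (β +o β')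
⌊⌋-⁀-⌊⌋ 𝔩 𝔪 b c b' c' = sym (ω·-+o b c b' c') , pointwise
  where
  open ≡-Reasoning
  β = ⟨ 0 , b , c ⟩
  β' = ⟨ 0 , b' , c' ⟩
  at𝒩 : List ℕ × ℕ → ℕ → ℕ
  at𝒩 x i = at (𝒩elt x) ⟨ 0 , 0 , i ⟩
  pointwise : ∀ γ → γ <o len (⌊ 𝔩 ⌋ β ⁀ ⌊ 𝔪 ⌋ β') →
              at (⌊ 𝔩 ⌋ β ⁀ ⌊ 𝔪 ⌋ β') γ ≡ at (⌊ splice β 𝔩 𝔪 ⌋ (β +o β')) γ
  pointwise γ _ with position (ω· β) γ
  ... | below γ<ωβ = begin
    at (⌊ 𝔩 ⌋ β ⁀ ⌊ 𝔪 ⌋ β') γ             ≡⟨ at-⁀ˡ (⌊ 𝔩 ⌋ β) (⌊ 𝔪 ⌋ β') γ<ωβ ⟩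
    at𝒩 (𝔩 (divω γ)) (o0 γ)               ≡⟨ cong (λ x → at𝒩 x (o0 γ)) (splice-< β 𝔩 𝔪 (divω γ) divωγ<β) ⟨
    at𝒩 (splice β 𝔩 𝔪 (divω γ)) (o0 γ)    ∎
    where divωγ<β = subst T (ltb-ω· b c γ) γ<ωβ
  ... | above δ = begin
    at (⌊ 𝔩 ⌋ β ⁀ ⌊ 𝔪 ⌋ β') (ω· β +o δ)                       ≡⟨ at-⁀ʳ (⌊ 𝔩 ⌋ β) (⌊ 𝔪 ⌋ β') δ ⟩
    at𝒩 (𝔪 (divω δ)) (o0 δ)                                    ≡⟨ cong (λ x → at𝒩 x (o0 δ)) (splice-+o β 𝔩 𝔪 (divω δ)) ⟨
    at𝒩 (splice β 𝔩 𝔪 (β +o divω δ)) (o0 δ)                    ≡⟨ cong₂ (λ d i → at𝒩 (splice β 𝔩 𝔪 d) i) (divω-ω·+o b c δ) (o0-ω·+o β δ) ⟨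
    at𝒩 (splice β 𝔩 𝔪 (divω (ω· β +o δ))) (o0 (ω· β +o δ))    ∎

prependFirst : List ℕ → Blocks → Blocks
prependFirst w 𝔩 ⟨ zero , zero , zero ⟩ = map₁ (w ++_) (𝔩 0o)
prependFirst w 𝔩 δ                      = 𝔩 δ

n+ω·β≡ω·β : ∀ n β → 0o <o ω· β → ⟨ 0 , 0 , n ⟩ +o ω· β ≡ ω· β
n+ω·β≡ω·β n ⟨ _ , zero  , suc _ ⟩ _ = refl
n+ω·β≡ω·β n ⟨ _ , suc _ , _     ⟩ _ = refl

fromList-⁀-⌊⌋ : ∀ w 𝔩 β → 0o <o ω· β → (fromList w ⁀ ⌊ 𝔩 ⌋ β) ≈ ⌊ prependFirst w 𝔩 ⌋ β
fromList-⁀-⌊⌋ w 𝔩 β 0<ωβ = n+ω·β≡ω·β (length w) β 0<ωβ , λ γ _ → pointwise γ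
  where
  pointwise : ∀ γ → at (fromList w ⁀ ⌊ 𝔩 ⌋ β) γ ≡ at (⌊ prependFirst w 𝔩 ⌋ β) γ
  pointwise ⟨ zero  , zero  , i ⟩ = sym (proj₂ (𝒩elt-++ w (proj₁ (𝔩 0o)) (proj₂ (𝔩 0o))) ⟨ 0 , 0 , i ⟩ _)
  pointwise ⟨ zero  , suc _ , _ ⟩ = refl
  pointwise ⟨ suc _ , _     , _ ⟩ = refl

In𝔏-resp-≈ : ∀ {s t} → s ≈ t → In𝔏 t → In𝔏 s
In𝔏-resp-≈ s≈t (w , β , 𝔩 , β<ω² , t≈) = w , β , 𝔩 , β<ω² , ≈-trans s≈t t≈

In𝔏-fromList : ∀ w → In𝔏 (fromList w)
In𝔏-fromList w = w , 0o , 𝔩 , refl , ≈-sym (begin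
  ⌊ 𝔩 ⌋ 0o ⁀ fromList w  ≈⟨ ⁀-congʳ (fromList w) (⌊⌋-0o 𝔩) ⟩
  εs ⁀ fromList w        ≈⟨ ⁀-identityˡ (fromList w) ⟩
  fromList w             ∎)
  where
  open SetoidReasoning ≈-setoid
  𝔩 : Blocks
  𝔩 _ = [] , 0

In𝔏-[_]s : ∀ n → In𝔏 [ n ]s
In𝔏-[ n ]s = In𝔏-resp-≈ (refl , pointwise) (In𝔏-fromList (n ∷ []))
  where
  pointwise : ∀ γ → γ <o ⟨ 0 , 0 , 1 ⟩ → n ≡ at (fromList (n ∷ [])) γ
  pointwise ⟨ zero , zero , zero ⟩ _ = refl

In𝔏-⁀ : ∀ l m → In𝔏 l → In𝔏 m → In𝔏 (l ⁀ m)
In𝔏-⁀ l m (v , ⟨ _ , b , c ⟩ , 𝔩 , refl , l≈) (w , ⟨ _ , b' , c' ⟩ , 𝔪 , refl , m≈) =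
  In𝔏-resp-≈ (⁀-cong l≈ m≈) (normal⁀normal b' c')
  where
  open SetoidReasoning ≈-setoid
  β = ⟨ 0 , b , c ⟩
  L = ⌊ 𝔩 ⌋ β
  V = fromList v
  W = fromList w
  nonempty : ∀ b' c' → let β' = ⟨ 0 , b' , c' ⟩ in
             0o <o ω· β' → o2 (β +o β') ≡ 0 → In𝔏 ((L ⁀ V) ⁀ (⌊ 𝔪 ⌋ β' ⁀ W))
  nonempty b' c' 0<ωβ' β+β'<ω² = w , β +o β' , splice β 𝔩 (prependFirst v 𝔪) , β+β'<ω² , (begin
    (L ⁀ V) ⁀ (M ⁀ W)                                ≈⟨ ⁀-assoc L V (M ⁀ W) ⟩
    L ⁀ (V ⁀ (M ⁀ W))                                ≈⟨ ⁀-congˡ L (⁀-assoc V M W) ⟨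
    L ⁀ ((V ⁀ M) ⁀ W)                                ≈⟨ ⁀-congˡ L (⁀-congʳ W (fromList-⁀-⌊⌋ v 𝔪 β' 0<ωβ')) ⟩
    L ⁀ (M' ⁀ W)                                     ≈⟨ ⁀-assoc L M' W ⟨
    (L ⁀ M') ⁀ W                                     ≈⟨ ⁀-congʳ W (⌊⌋-⁀-⌊⌋ 𝔩 (prependFirst v 𝔪) b c b' c') ⟩
    ⌊ splice β 𝔩 (prependFirst v 𝔪) ⌋ (β +o β') ⁀ W  ∎)
    where
    β' = ⟨ 0 , b' , c' ⟩
    M  = ⌊ 𝔪 ⌋ β'
    M' = ⌊ prependFirst v 𝔪 ⌋ β'
  normal⁀normal : ∀ b' c' → In𝔏 ((L ⁀ V) ⁀ (⌊ 𝔪 ⌋ ⟨ 0 , b' , c' ⟩ ⁀ W))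
  normal⁀normal zero zero = v ++ w , β , 𝔩 , refl , (begin
    (L ⁀ V) ⁀ (⌊ 𝔪 ⌋ 0o ⁀ W)  ≈⟨ ⁀-congˡ (L ⁀ V) (⁀-congʳ W (⌊⌋-0o 𝔪)) ⟩
    (L ⁀ V) ⁀ (εs ⁀ W)        ≈⟨ ⁀-congˡ (L ⁀ V) (⁀-identityˡ W) ⟩
    (L ⁀ V) ⁀ W               ≈⟨ ⁀-assoc L V W ⟩
    L ⁀ (V ⁀ W)               ≈⟨ ⁀-congˡ L (fromList-++ v w) ⟨
    L ⁀ fromList (v ++ w)     ∎)
  normal⁀normal zero    (suc c') = nonempty zero (suc c') _ refl
  normal⁀normal (suc b') c'      = nonempty (suc b') c' _ refl

lemma4p10 : M₂-isStructure × M₂⊨T₁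
lemma4p10 =
  (In𝔏-fromList [] , (λ n l → In𝔏-⁀ [ n ]s l In𝔏-[ n ]s) , In𝔏-⁀) ,
  (λ x X _ → εs≉[x]⁀X x X) ,
  (λ x X y Y _ _ → [x]⁀-injective x X y Y) ,
  (λ Y _ → ⁀-identityˡ Y) ,
  (λ x X Y _ _ → ⁀-assoc [ x ]s X Y)
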